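{- Let $\Theta=\exists\vec X\,\forall\vec Y\,\exists\vec Z\,\phi$ be a QBF and let $\Pi_\Theta$ be the ELP obtained by applying the Shen–Eiter construction (described in the context) to the extension $\Theta^\uparrow$. Then $\Theta$ is valid if and only if $\Pi_\Theta$ has at least one candidate world view.
   Context: QBFs: $\exists\vec X\,\forall\vec Y\,\exists\vec Z\,\phi$ with disjoint sets of propositional atoms and $\phi=\bigwedge_{i=1}^kC_i$ a CNF over their union. Extension: $\Theta^\uparrow=\exists\vec X\,\forall(\vec Y\cup\vec V)\,\exists\vec Z\,\bigwedge_{i=1}^k(v_i\vee C_i)$ with fresh atoms $\vec V=\{v_1,\ldots,v_k\}$. Shen–Eiter construction: for a QBF $\exists\vec X\,\forall\vec Y'\,\exists\vec Z\,\bigwedge_i D_i$, the ELP has atoms $w,\overline w$ for each variable $w$, plus fresh atoms $U,W$, and rules: for each $x\in\vec X$: $x\leftarrow\mathbf{not}\,\overline x$ and $\overline x\leftarrow\mathbf{not}\,x$; for each $y\in\vec Y'$: $y\leftarrow\neg\overline y$ and $\overline y\leftarrow\neg y$; for each $z\in\vec Z$: $z\vee\overline z\leftarrow$; for each clause $D_i$: $U\leftarrow L^*$ for all literals $L$ of $D_i$ (conjunctively in the body), where $w^*=\overline w$ and $(\neg w)^*=w$; for each $z\in\vec Z$: $z\leftarrow U$ and $\overline z\leftarrow U$; and $W\leftarrow\mathbf{not}\,W,\mathbf{not}\,\neg U$. Here $\neg$ is default negation and $\mathbf{not}$ epistemic negation. ELP semantics: a ground ELP $\Pi$ has rules with disjunctive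 heads of atoms and bodies of literals, epistemic literals $\mathbf{not}\,\ell$ and their default negations; $\mathrm{elit}(\Pi)$ is its set of epistemic literals. For $\Phi\subseteq\mathrm{elit}(\Pi)$, the epistemic reduct $\Pi^\Phi$ replaces each $\mathbf{not}\,\ell\in\Phi$ by $\top$ and each $\mathbf{not}\,\ell\notin\Phi$ by $\neg\ell$ (double negation interpreted by FLP semantics); $\mathcal{M}=AS(\Pi^\Phi)$ (its answer sets) is a candidate world view iff $\mathcal{M}\neq\emptyset$, for each $\mathbf{not}\,\ell\in\Phi$ some $M\in\mathcal{M}$ falsifies $\ell$, and for each $\mathbf{not}\,\ell\in\mathrm{elit}(\Pi)\setminus\Phi$ every $M\in\mathcal{M}$ satisfies $\ell$. -}

module Defs where

open import Data.Bool using (Bool; true; false; if_then_else_)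
open import Data.Nat using (ℕ; _+_)
open import Data.Fin using (Fin; _↑ˡ_; _↑ʳ_)
open import Data.Sum using (_⊎_; inj₁; inj₂)
open import Data.Product using (Σ; Σ-syntax; ∃; ∃-syntax; _×_; _,_)
open import Data.List using (List; []; _∷_; map; tabulate; concat; _++_)
open import Data.List.Relation.Unary.All using (All)
open import Data.List.Relation.Unary.Any using (Any)
open import Data.List.Membership.Propositional using (_∈_)
open import Data.Unit using (⊤)
open import Data.Empty using (⊥)
open import Relation.Nullary using (¬_)
open import Relation.Binary.PropositionalEquality using (_≡_)

Var : ℕ → ℕ → ℕ → Set
Var nx ny nz = Fin nx ⊎ Fin ny ⊎ Fin nz

data QLit (V : Set) : Set where
  posQ : V → QLit V
  negQ : V → QLit V

record QBF : Set where
  field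
    nx ny nz k : ℕ
    matrix     : Fin k → List (QLit (Var nx ny nz))

open QBF public

satQLit : {V : Set} → (V → Bool) → QLit V → Set
satQLit σ (posQ v) = σ v ≡ true
satQLit σ (negQ v) = σ v ≡ false

assign : {nx ny nz : ℕ} → (Fin nx → Bool) → (Fin ny → Bool) → (Fin nz → Bool) →
         Var nx ny nz → Bool
assign ax ay az (inj₁ x)        = ax x
assign ax ay az (inj₂ (inj₁ y)) = ay y
assign ax ay az (inj₂ (inj₂ z)) = az z

Valid : QBF → Set
Valid Θ = Σ[ ax ∈ (Fin (nx Θ) → Bool) ] ∀ (ay : Fin (ny Θ) → Bool) →
          Σ[ az ∈ (Fin (nz Θ) → Bool) ] ∀ (i : Fin (k Θ)) →
          Any (satQLit (assign ax ay az)) (matrix Θ i)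

-- The extension Θ↑ : universal block Y ∪ V, with V = {v_0..v_{k-1}}
-- encoded as Fin (ny + k): y ↦ y ↑ˡ k, v_i ↦ raise ny i.
liftVar : {nx ny nz : ℕ} (k : ℕ) → Var nx ny nz → Var nx (ny + k) nz
liftVar k (inj₁ x)        = inj₁ x
liftVar k (inj₂ (inj₁ y)) = inj₂ (inj₁ (y ↑ˡ k))
liftVar k (inj₂ (inj₂ z)) = inj₂ (inj₂ z)

liftLit : {nx ny nz : ℕ} (k : ℕ) → QLit (Var nx ny nz) → QLit (Var nx (ny + k) nz)
liftLit k (posQ v) = posQ (liftVar k v)
liftLit k (negQ v) = negQ (liftVar k v)

extend : QBF → QBF
extend Θ = record
  { nx = nx Θ ; ny = ny Θ + k Θ ; nz = nz Θ ; k = k Θ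
  ; matrix = λ i → posQ (inj₂ (inj₁ (ny Θ ↑ʳ i))) ∷ map (liftLit (k Θ)) (matrix Θ i)
  }

-- objective literals: a  or  ¬a  (¬ = default negation)
data Lit (A : Set) : Set where
  pos : A → Lit A
  neg : A → Lit A

-- body elements: objective literal ℓ, epistemic literal  not ℓ,
-- and default negation of an epistemic literal  ¬ not ℓ
data BodyElem (A : Set) : Set where
  lit  : Lit A → BodyElem A
  epi  : Lit A → BodyElem A
  nepi : Lit A → BodyElem A

infix 4 _⇐_
record Rule (A : Set) : Set where
  constructor _⇐_
  field
    head : List A
    body : List (BodyElem A)

open Rule public

ELP : Set → Set
ELP A = List (Rule A)

Elit : {A : Set} → ELP A → Lit A → Set
Elit Π ℓ = Any (λ r → (epi ℓ ∈ body r) ⊎ (nepi ℓ ∈ body r)) Π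

-- formulas occurring in bodies of epistemic reducts (nested default negation)
data BF (A : Set) : Set where
  bl   : Lit A → BF A
  btop : BF A
  bbot : BF A
  bneg : BF A → BF A

infix 4 _⇐ᵒ_
record ORule (A : Set) : Set where
  constructor _⇐ᵒ_
  field
    ohead : List A
    obody : List (BF A)

open ORule public

-- Φ ⊆ elit(Π) is given by its characteristic function on ℓ (Φ ℓ = true iff  not ℓ ∈ Φ)
reduceElem : {A : Set} → (Lit A → Bool) → BodyElem A → BF A
reduceElem Φ (lit ℓ)  = bl ℓ
reduceElem Φ (epi ℓ)  = if Φ ℓ then btop else bneg (bl ℓ)
reduceElem Φ (nepi ℓ) = if Φ ℓ then bneg btop else bneg (bneg (bl ℓ))

reduct : {A : Set} → ELP A → (Lit A → Bool) → List (ORule A)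
reduct Π Φ = map (λ r → head r ⇐ᵒ map (reduceElem Φ) (body r)) Π

Interp : Set → Set
Interp A = A → Bool

satLit : {A : Set} → Interp A → Lit A → Set
satLit M (pos a) = M a ≡ true
satLit M (neg a) = ¬ (M a ≡ true)

satBF : {A : Set} → Interp A → BF A → Set
satBF M (bl ℓ)   = satLit M ℓ
satBF M btop     = ⊤
satBF M bbot     = ⊥
satBF M (bneg f) = ¬ satBF M f

BodySat : {A : Set} → Interp A → ORule A → Set
BodySat M r = All (satBF M) (obody r)

HeadSat : {A : Set} → Interp A → ORule A → Set
HeadSat M r = Any (λ a → M a ≡ true) (ohead r)

IsModel : {A : Set} → List (ORule A) → Interp A → Set
IsModel P M = ∀ r → r ∈ P → BodySat M r → HeadSat M r

-- N is a model of the FLP reduct fP^M = { r ∈ P | M ⊨ body(r) }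
IsModelFLP : {A : Set} → List (ORule A) → Interp A → Interp A → Set
IsModelFLP P M N = ∀ r → r ∈ P → BodySat M r → BodySat N r → HeadSat N r

_⊂_ : {A : Set} → Interp A → Interp A → Set
N ⊂ M = (∀ a → N a ≡ true → M a ≡ true) × (∃[ a ] (M a ≡ true × N a ≡ false))

AnswerSet : {A : Set} → List (ORule A) → Interp A → Set
AnswerSet P M = IsModel P M × (∀ N → N ⊂ M → ¬ IsModelFLP P M N)

CandidateWorldView : {A : Set} → ELP A → (Lit A → Bool) → Set
CandidateWorldView Π Φ =
  (∀ ℓ → Φ ℓ ≡ true → Elit Π ℓ) ×
  (∃[ M ] AnswerSet (reduct Π Φ) M) ×
  (∀ ℓ → Φ ℓ ≡ true → ∃[ M ] (AnswerSet (reduct Π Φ) M × ¬ satLit M ℓ)) ×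
  (∀ ℓ → Elit Π ℓ → Φ ℓ ≡ false → ∀ M → AnswerSet (reduct Π Φ) M → satLit M ℓ)

HasCandidateWorldView : {A : Set} → ELP A → Set
HasCandidateWorldView Π = ∃[ Φ ] CandidateWorldView Π Φ

data SEAtom (V : Set) : Set where
  orig : V → SEAtom V
  bar  : V → SEAtom V
  U W  : SEAtom V

star : {V : Set} → QLit V → SEAtom V
star (posQ w) = bar w
star (negQ w) = orig w

shenEiter : (Θ : QBF) → ELP (SEAtom (Var (nx Θ) (ny Θ) (nz Θ)))
shenEiter Θ =
     concat (tabulate {n = nx Θ} λ x →
        (orig (X x) ∷ [] ⇐ epi (pos (bar (X x))) ∷ [])
      ∷ (bar (X x) ∷ [] ⇐ epi (pos (orig (X x))) ∷ []) ∷ [])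
  ++ concat (tabulate {n = ny Θ} λ y →
        (orig (Y y) ∷ [] ⇐ lit (neg (bar (Y y))) ∷ [])
      ∷ (bar (Y y) ∷ [] ⇐ lit (neg (orig (Y y))) ∷ []) ∷ [])
  ++ tabulate {n = nz Θ} (λ z → orig (Z z) ∷ bar (Z z) ∷ [] ⇐ [])
  ++ tabulate {n = k Θ} (λ i → U ∷ [] ⇐ map (λ L → lit (pos (star L))) (matrix Θ i))
  ++ concat (tabulate {n = nz Θ} λ z →
        (orig (Z z) ∷ [] ⇐ lit (pos U) ∷ [])
      ∷ (bar (Z z) ∷ [] ⇐ lit (pos U) ∷ []) ∷ [])
  ++ (W ∷ [] ⇐ epi (pos W) ∷ epi (neg U) ∷ []) ∷ []
  where
    X : Fin (nx Θ) → Var (nx Θ) (ny Θ) (nz Θ)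
    X = inj₁
    Y : Fin (ny Θ) → Var (nx Θ) (ny Θ) (nz Θ)
    Y y = inj₂ (inj₁ y)
    Z : Fin (nz Θ) → Var (nx Θ) (ny Θ) (nz Θ)
    Z z = inj₂ (inj₂ z)

PiTheta : (Θ : QBF) → ELP (SEAtom (Var (nx Θ) (ny Θ + k Θ) (nz Θ)))
PiTheta Θ = shenEiter (extend Θ)

module Submission where

-- The extension preserves validity (pad the fresh universal atoms with false), and the
-- Shen–Eiter program of an arbitrary QBF has a candidate world view iff the QBF is valid.
-- For a valid QBF with X-witness ax, guess not W together with not x̄ or not x according to
-- ax x. Encodings of satisfying assignments are answer sets of the reduct, and no answer
-- set contains U: one that did would be saturated, so it would properly contain the
-- encoding of a satisfying assignment for its own Y-part, which is a model.
-- Conversely, a candidate world view must contain not W and omit not ¬U, so all its answer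
-- sets omit U; reading ax off Φ, a Y-assignment with no Z-completion would make the
-- saturated interpretation an answer set containing U.

open import Defs
open import Function.Base using (_∘_; id; const)
open import Function.Bundles using (_⇔_; mk⇔)
open import Function.Properties.Equivalence using () renaming (trans to ⇔-trans)
open import Data.Bool using (Bool; true; false; not)
open import Data.Bool.Properties using (not-injective; not-¬; ¬-not) renaming (_≟_ to _≟ᵇ_)
open import Data.Nat using (ℕ; _+_)
open import Data.Fin using (Fin; _↑ˡ_)
open import Data.Fin.Properties using (all?; ¬∀⟶∃¬)
open import Data.Fin.Subset.Properties using (anySubset?)
open import Data.Vec using (lookup; tabulate)
open import Data.Vec.Properties using (lookup∘tabulate)
import Data.Vec.Functional as Vector
open import Data.Vec.Functional.Properties using (lookup-++ˡ; lookup-++ʳ)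
open import Data.Sum using (_⊎_; inj₁; inj₂)
open import Data.Product using (∃-syntax; _×_; _,_; proj₁; proj₂)
open import Data.List using (List; []; _∷_; map; concat; _++_)
import Data.List as List
open import Data.List.Relation.Unary.All as All using (All; []; _∷_)
import Data.List.Relation.Unary.All.Properties as All
open import Data.List.Relation.Unary.Any as Any using (Any; here; there)
import Data.List.Relation.Unary.Any.Properties as Any
open import Data.List.Membership.Propositional using (_∈_)
open import Data.List.Membership.Propositional.Properties
  using (∈-map⁺; ∈-++⁺ˡ; ∈-++⁺ʳ; ∈-concat⁺′; ∈-tabulate⁺)
open import Data.Unit using (⊤; tt)
open import Data.Empty using (⊥; ⊥-elim)
open import Relation.Nullary using (¬_; Dec)
open import Relation.Nullary.Decidable using (decidable-stable; map′)
open import Relation.Binary.PropositionalEquality using (_≡_; refl; sym; trans; cong)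

pattern X x = inj₁ x
pattern Y y = inj₂ (inj₁ y)
pattern Z z = inj₂ (inj₂ z)

Satisfies : (Θ : QBF) → (Var (nx Θ) (ny Θ) (nz Θ) → Bool) → Set
Satisfies Θ σ = ∀ i → Any (satQLit σ) (matrix Θ i)

satQLit? : {V : Set} (σ : V → Bool) (L : QLit V) → Dec (satQLit σ L)
satQLit? σ (posQ v) = σ v ≟ᵇ true
satQLit? σ (negQ v) = σ v ≟ᵇ false

satQLit-resp : {V : Set} {σ τ : V → Bool} → (∀ v → σ v ≡ τ v) →
               ∀ {L} → satQLit σ L → satQLit τ L
satQLit-resp σ≗τ {posQ v} p = trans (sym (σ≗τ v)) p
satQLit-resp σ≗τ {negQ v} p = trans (sym (σ≗τ v)) p

module _ (Θ : QBF) where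

  satisfies? : ∀ σ → Dec (Satisfies Θ σ)
  satisfies? σ = all? λ i → Any.any? (satQLit? σ) (matrix Θ i)

  satisfiable? : ∀ ax ay → Dec (∃[ az ] Satisfies Θ (assign ax ay az))
  satisfiable? ax ay =
    map′ (λ (s , sat) → lookup s , sat)
         (λ (az , sat) → tabulate az , λ i → Any.map (satQLit-resp assign-tabulate) (sat i))
         (anySubset? λ s → satisfies? (assign ax ay (lookup s)))
    where
    assign-tabulate : ∀ {az} v → assign ax ay az v ≡ assign ax ay (lookup (tabulate az)) v
    assign-tabulate (X x) = refl
    assign-tabulate (Y y) = refl
    assign-tabulate {az} (Z z) = sym (lookup∘tabulate az z)

module _ {nx ny nz : ℕ} (k : ℕ) {ax : Fin nx → Bool} {az : Fin nz → Bool}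
         {ay : Fin ny → Bool} {ay↑ : Fin (ny + k) → Bool}
         (agree : ∀ y → ay↑ (y ↑ˡ k) ≡ ay y) where

  assign-liftVar : ∀ v → assign ax ay↑ az (liftVar k v) ≡ assign ax ay az v
  assign-liftVar (X x) = refl
  assign-liftVar (Y y) = agree y
  assign-liftVar (Z z) = refl

  liftLit-sat⁺ : ∀ {L} → satQLit (assign ax ay az) L → satQLit (assign ax ay↑ az) (liftLit k L)
  liftLit-sat⁺ {posQ v} p = trans (assign-liftVar v) p
  liftLit-sat⁺ {negQ v} p = trans (assign-liftVar v) p

  liftLit-sat⁻ : ∀ {L} → satQLit (assign ax ay↑ az) (liftLit k L) → satQLit (assign ax ay az) L
  liftLit-sat⁻ {posQ v} p = trans (sym (assign-liftVar v)) p
  liftLit-sat⁻ {negQ v} p = trans (sym (assign-liftVar v)) p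

extend-valid : (Θ : QBF) → Valid Θ ⇔ Valid (extend Θ)
extend-valid Θ = mk⇔ to from
  where
  to : Valid Θ → Valid (extend Θ)
  to (ax , valid) = ax , λ ay↑ →
    let az , sat = valid (ay↑ ∘ (_↑ˡ k Θ)) in
    az , λ i → there (Any.map⁺ (Any.map (liftLit-sat⁺ (k Θ) λ _ → refl) (sat i)))

  from : Valid (extend Θ) → Valid Θ
  from (ax , valid) = ax , λ ay → proj₁ (valid (padFalse ay)) , clause ay
    where
    padFalse : (Fin (ny Θ) → Bool) → Fin (ny Θ + k Θ) → Bool
    padFalse ay = ay Vector.++ Vector.replicate (k Θ) false

    clause : ∀ ay i → Any (satQLit (assign ax ay (proj₁ (valid (padFalse ay))))) (matrix Θ i)
    clause ay i with proj₂ (valid (padFalse ay)) i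
    ... | there p = Any.map (liftLit-sat⁻ (k Θ) (lookup-++ˡ ay _)) (Any.map⁻ p)
    ... | here v-true with trans (sym (lookup-++ʳ ay _ i)) v-true
    ...   | ()

not-both : ∀ {b} → b ≡ true → ¬ not b ≡ true
not-both refl ()

module _ {A : Set} where

  reduceRule : (Lit A → Bool) → Rule A → ORule A
  reduceRule Φ r = head r ⇐ᵒ map (reduceElem Φ) (body r)

  reduceRule∈reduct : ∀ {Π Φ r} → r ∈ Π → reduceRule Φ r ∈ reduct Π Φ
  reduceRule∈reduct {Φ = Φ} = ∈-map⁺ (reduceRule Φ)

  EpistemicIn : (Lit A → Set) → BodyElem A → Set
  EpistemicIn E (lit _)  = ⊤
  EpistemicIn E (epi ℓ)  = E ℓ
  EpistemicIn E (nepi ℓ) = E ℓ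

  Elit-bounded : ∀ {E Π ℓ} → All (All (EpistemicIn E) ∘ body) Π → Elit Π ℓ → E ℓ
  Elit-bounded (r ∷ _)  (here (inj₁ e)) = All.lookup r e
  Elit-bounded (r ∷ _)  (here (inj₂ e)) = All.lookup r e
  Elit-bounded (_ ∷ rs) (there e)       = Elit-bounded rs e

  epi∈⇒Elit : ∀ {Π : ELP A} {r ℓ} → r ∈ Π → epi ℓ ∈ body r → Elit Π ℓ
  epi∈⇒Elit r∈ e = Any.map (λ { refl → inj₁ e }) r∈

  _⊆_ : Interp A → Interp A → Set
  N ⊆ M = ∀ a → N a ≡ true → M a ≡ true

  model⇒FLP : ∀ {P : List (ORule A)} {M N} → IsModel P N → IsModelFLP P M N
  model⇒FLP model r r∈ _ = model r r∈

  answerSet-intro : ∀ {P : List (ORule A)} {M} → IsModel P M →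
                    (∀ N → N ⊆ M → IsModelFLP P M N → M ⊆ N) → AnswerSet P M
  answerSet-intro model forced =
    model , λ N (N⊆M , a , Ma , Na) flp → not-¬ (forced N N⊆M flp a Ma) Na

-- Φ is a parameter rather than an implicit argument so that M and ℓ can be inferred
-- from the (reduced) body literal at use sites.
module Epistemic {A : Set} (Φ : Lit A → Bool) {M : Interp A} {ℓ : Lit A} where

  epi-⊤ : Φ ℓ ≡ true → satBF M (reduceElem Φ (epi ℓ))
  epi-⊤ on rewrite on = tt

  epi-¬⁺ : Φ ℓ ≡ false → ¬ satLit M ℓ → satBF M (reduceElem Φ (epi ℓ))
  epi-¬⁺ off rewrite off = id

  epi-¬⁻ : Φ ℓ ≡ false → satBF M (reduceElem Φ (epi ℓ)) → ¬ satLit M ℓ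
  epi-¬⁻ off rewrite off = id

module ShenEiter (Θ : QBF) where

  Atom : Set
  Atom = SEAtom (Var (nx Θ) (ny Θ) (nz Θ))

  Π : ELP Atom
  Π = shenEiter Θ

  x-rule x̄-rule : Fin (nx Θ) → Rule Atom
  x-rule x = orig (X x) ∷ [] ⇐ epi (pos (bar (X x))) ∷ []
  x̄-rule x = bar (X x) ∷ [] ⇐ epi (pos (orig (X x))) ∷ []

  y-rule ȳ-rule : Fin (ny Θ) → Rule Atom
  y-rule y = orig (Y y) ∷ [] ⇐ lit (neg (bar (Y y))) ∷ []
  ȳ-rule y = bar (Y y) ∷ [] ⇐ lit (neg (orig (Y y))) ∷ []

  z-rule : Fin (nz Θ) → Rule Atom
  z-rule z = orig (Z z) ∷ bar (Z z) ∷ [] ⇐ []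

  clause-rule : Fin (k Θ) → Rule Atom
  clause-rule i = U ∷ [] ⇐ map (λ L → lit (pos (star L))) (matrix Θ i)

  z-sat-rule z̄-sat-rule : Fin (nz Θ) → Rule Atom
  z-sat-rule z = orig (Z z) ∷ [] ⇐ lit (pos U) ∷ []
  z̄-sat-rule z = bar (Z z) ∷ [] ⇐ lit (pos U) ∷ []

  W-rule : Rule Atom
  W-rule = W ∷ [] ⇐ epi (pos W) ∷ epi (neg U) ∷ []

  record ForEachRule (Q : Rule Atom → Set) : Set where
    field
      on-x       : ∀ x → Q (x-rule x)
      on-x̄       : ∀ x → Q (x̄-rule x)
      on-y       : ∀ y → Q (y-rule y)
      on-ȳ       : ∀ y → Q (ȳ-rule y)
      on-z       : ∀ z → Q (z-rule z)
      on-clause  : ∀ i → Q (clause-rule i)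
      on-z-sat   : ∀ z → Q (z-sat-rule z)
      on-z̄-sat   : ∀ z → Q (z̄-sat-rule z)
      on-W       : Q W-rule

  open ForEachRule

  forEachRule : ∀ {Q} → ForEachRule Q → All Q Π
  forEachRule q =
    All.++⁺ (All.concat⁺ (All.tabulate⁺ λ x → on-x q x ∷ on-x̄ q x ∷ []))
    (All.++⁺ (All.concat⁺ (All.tabulate⁺ λ y → on-y q y ∷ on-ȳ q y ∷ []))
    (All.++⁺ (All.tabulate⁺ (on-z q))
    (All.++⁺ (All.tabulate⁺ (on-clause q))
    (All.++⁺ (All.concat⁺ (All.tabulate⁺ λ z → on-z-sat q z ∷ on-z̄-sat q z ∷ []))
    (on-W q ∷ [])))))

  private
    pairs : {A : Set} {n : ℕ} → (Fin n → A) → (Fin n → A) → List A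
    pairs f g = concat (List.tabulate λ j → f j ∷ g j ∷ [])

    ∈-pairsˡ : {A : Set} {n : ℕ} {f g : Fin n → A} (i : Fin n) → f i ∈ pairs f g
    ∈-pairsˡ i = ∈-concat⁺′ (here refl) (∈-tabulate⁺ i)

    ∈-pairsʳ : {A : Set} {n : ℕ} {f g : Fin n → A} (i : Fin n) → g i ∈ pairs f g
    ∈-pairsʳ i = ∈-concat⁺′ (there (here refl)) (∈-tabulate⁺ i)

    xs ys zs cs : List (Rule Atom)
    xs = pairs x-rule x̄-rule
    ys = pairs y-rule ȳ-rule
    zs = List.tabulate z-rule
    cs = List.tabulate clause-rule

    after-guesses : ∀ {r} → r ∈ pairs z-sat-rule z̄-sat-rule ++ W-rule ∷ [] → r ∈ Π
    after-guesses = ∈-++⁺ʳ xs ∘ ∈-++⁺ʳ ys ∘ ∈-++⁺ʳ zs ∘ ∈-++⁺ʳ cs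

  x-rule∈Π : ∀ x → x-rule x ∈ Π
  x-rule∈Π x = ∈-++⁺ˡ (∈-pairsˡ x)

  x̄-rule∈Π : ∀ x → x̄-rule x ∈ Π
  x̄-rule∈Π x = ∈-++⁺ˡ (∈-pairsʳ x)

  y-rule∈Π : ∀ y → y-rule y ∈ Π
  y-rule∈Π y = ∈-++⁺ʳ xs (∈-++⁺ˡ (∈-pairsˡ y))

  ȳ-rule∈Π : ∀ y → ȳ-rule y ∈ Π
  ȳ-rule∈Π y = ∈-++⁺ʳ xs (∈-++⁺ˡ (∈-pairsʳ y))

  z-rule∈Π : ∀ z → z-rule z ∈ Π
  z-rule∈Π z = ∈-++⁺ʳ xs (∈-++⁺ʳ ys (∈-++⁺ˡ (∈-tabulate⁺ z)))

  clause-rule∈Π : ∀ i → clause-rule i ∈ Π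
  clause-rule∈Π i = ∈-++⁺ʳ xs (∈-++⁺ʳ ys (∈-++⁺ʳ zs (∈-++⁺ˡ (∈-tabulate⁺ i))))

  z-sat-rule∈Π : ∀ z → z-sat-rule z ∈ Π
  z-sat-rule∈Π z = after-guesses (∈-++⁺ˡ (∈-pairsˡ z))

  z̄-sat-rule∈Π : ∀ z → z̄-sat-rule z ∈ Π
  z̄-sat-rule∈Π z = after-guesses (∈-++⁺ˡ (∈-pairsʳ z))

  W-rule∈Π : W-rule ∈ Π
  W-rule∈Π = after-guesses (∈-++⁺ʳ (pairs z-sat-rule z̄-sat-rule) (here refl))

  data IsElit : Lit Atom → Set where
    elit-x  : ∀ x → IsElit (pos (orig (X x)))
    elit-x̄  : ∀ x → IsElit (pos (bar (X x)))
    elit-W  : IsElit (pos W)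
    elit-¬U : IsElit (neg U)

  IsElit⇒Elit : ∀ {ℓ} → IsElit ℓ → Elit Π ℓ
  IsElit⇒Elit (elit-x x) = epi∈⇒Elit (x̄-rule∈Π x) (here refl)
  IsElit⇒Elit (elit-x̄ x) = epi∈⇒Elit (x-rule∈Π x) (here refl)
  IsElit⇒Elit elit-W     = epi∈⇒Elit W-rule∈Π (here refl)
  IsElit⇒Elit elit-¬U    = epi∈⇒Elit W-rule∈Π (there (here refl))

  Elit⇒IsElit : ∀ {ℓ} → Elit Π ℓ → IsElit ℓ
  Elit⇒IsElit = Elit-bounded (forEachRule epistemic)
    where
    epistemic : ForEachRule (All (EpistemicIn IsElit) ∘ body)
    epistemic .on-x x      = elit-x̄ x ∷ []
    epistemic .on-x̄ x      = elit-x x ∷ []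
    epistemic .on-y _      = tt ∷ []
    epistemic .on-ȳ _      = tt ∷ []
    epistemic .on-z _      = []
    epistemic .on-clause i = All.map⁺ (All.universal (λ _ → tt) (matrix Θ i))
    epistemic .on-z-sat _  = tt ∷ []
    epistemic .on-z̄-sat _  = tt ∷ []
    epistemic .on-W        = elit-W ∷ elit-¬U ∷ []

  module Reduct (Φ : Lit Atom → Bool) where

    open Epistemic Φ public

    P : List (ORule Atom)
    P = reduct Π Φ

    forEachReducedRule : ∀ {Q} → ForEachRule (Q ∘ reduceRule Φ) → ∀ r → r ∈ P → Q r
    forEachReducedRule q _ = All.lookup (All.map⁺ (forEachRule q))

    clause-body⁺ : ∀ {M i} → All (λ L → M (star L) ≡ true) (matrix Θ i) →
                   BodySat M (reduceRule Φ (clause-rule i))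
    clause-body⁺ = All.map⁺ ∘ All.map⁺

    clause-body⁻ : ∀ {M i} → BodySat M (reduceRule Φ (clause-rule i)) →
                   All (λ L → M (star L) ≡ true) (matrix Θ i)
    clause-body⁻ = All.map⁻ ∘ All.map⁻

    module _ {M N : Interp Atom} (flp : IsModelFLP P M N) where

      fires : ∀ {r} → r ∈ Π → BodySat M (reduceRule Φ r) → BodySat N (reduceRule Φ r) →
              HeadSat N (reduceRule Φ r)
      fires r∈ = flp _ (reduceRule∈reduct r∈)

      x-fact : ∀ {x} → Φ (pos (bar (X x))) ≡ true → N (orig (X x)) ≡ true
      x-fact {x} on = Any.singleton⁻ (fires (x-rule∈Π x) (epi-⊤ on ∷ []) (epi-⊤ on ∷ []))

      x̄-fact : ∀ {x} → Φ (pos (orig (X x))) ≡ true → N (bar (X x)) ≡ true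
      x̄-fact {x} on = Any.singleton⁻ (fires (x̄-rule∈Π x) (epi-⊤ on ∷ []) (epi-⊤ on ∷ []))

      x-default : ∀ {x} → ¬ M (bar (X x)) ≡ true → ¬ N (bar (X x)) ≡ true → N (orig (X x)) ≡ true
      x-default {x} ¬Mx̄ ¬Nx̄ with Φ (pos (bar (X x))) in eq
      ... | true  = x-fact eq
      ... | false = Any.singleton⁻ (fires (x-rule∈Π x) (epi-¬⁺ eq ¬Mx̄ ∷ []) (epi-¬⁺ eq ¬Nx̄ ∷ []))

      y-default : ∀ {y} → ¬ M (bar (Y y)) ≡ true → ¬ N (bar (Y y)) ≡ true → N (orig (Y y)) ≡ true
      y-default {y} ¬Mȳ ¬Nȳ = Any.singleton⁻ (fires (y-rule∈Π y) (¬Mȳ ∷ []) (¬Nȳ ∷ []))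

      ȳ-default : ∀ {y} → ¬ M (orig (Y y)) ≡ true → ¬ N (orig (Y y)) ≡ true → N (bar (Y y)) ≡ true
      ȳ-default {y} ¬My ¬Ny = Any.singleton⁻ (fires (ȳ-rule∈Π y) (¬My ∷ []) (¬Ny ∷ []))

      z-choice : ∀ {z} → N (orig (Z z)) ≡ true ⊎ N (bar (Z z)) ≡ true
      z-choice {z} with fires (z-rule∈Π z) [] []
      ... | here Nz         = inj₁ Nz
      ... | there (here Nz̄) = inj₂ Nz̄

      U-derived : ∀ {i} → All (λ L → M (star L) ≡ true) (matrix Θ i) →
                  All (λ L → N (star L) ≡ true) (matrix Θ i) → N U ≡ true
      U-derived {i} Mstars Nstars =
        Any.singleton⁻ (fires (clause-rule∈Π i) (clause-body⁺ Mstars) (clause-body⁺ Nstars))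

      z-saturated : ∀ {z} → M U ≡ true → N U ≡ true → N (orig (Z z)) ≡ true
      z-saturated {z} MU NU = Any.singleton⁻ (fires (z-sat-rule∈Π z) (MU ∷ []) (NU ∷ []))

      z̄-saturated : ∀ {z} → M U ≡ true → N U ≡ true → N (bar (Z z)) ≡ true
      z̄-saturated {z} MU NU = Any.singleton⁻ (fires (z̄-sat-rule∈Π z) (MU ∷ []) (NU ∷ []))

      W-derived : Φ (pos W) ≡ true → Φ (neg U) ≡ false → M U ≡ true → N U ≡ true → N W ≡ true
      W-derived W∈Φ ¬U∉Φ MU NU =
        Any.singleton⁻ (fires W-rule∈Π (epi-⊤ W∈Φ ∷ epi-¬⁺ ¬U∉Φ (λ ¬MU → ¬MU MU) ∷ [])
                                       (epi-⊤ W∈Φ ∷ epi-¬⁺ ¬U∉Φ (λ ¬NU → ¬NU NU) ∷ []))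

  module Forward (ax : Fin (nx Θ) → Bool) where

    guess : Lit Atom → Bool
    guess (pos (orig (X x))) = not (ax x)
    guess (pos (bar (X x)))  = ax x
    guess (pos W)            = true
    guess _                  = false

    open Reduct guess

    encode : (Fin (ny Θ) → Bool) → (Fin (nz Θ) → Bool) → Interp Atom
    encode ay az (orig v) = assign ax ay az v
    encode ay az (bar v)  = not (assign ax ay az v)
    encode ay az U        = false
    encode ay az W        = false

    star-falsified : ∀ {ay az L} → satQLit (assign ax ay az) L → ¬ encode ay az (star L) ≡ true
    star-falsified {L = posQ v} sat = not-both sat
    star-falsified {L = negQ v} sat = not-¬ sat

    encode-model : ∀ {ay az} → Satisfies Θ (assign ax ay az) → IsModel P (encode ay az)
    encode-model {ay} {az} sat = forEachReducedRule model
      where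
      M = encode ay az
      model : ForEachRule λ r → BodySat M (reduceRule guess r) → HeadSat M (reduceRule guess r)
      model .on-x x (b ∷ [])  = here (¬-not λ off → epi-¬⁻ {ℓ = pos (bar (X x))} off b (cong not off))
      model .on-x̄ x (b ∷ [])  = here (¬-not λ off → epi-¬⁻ {ℓ = pos (orig (X x))} off b (not-injective off))
      model .on-y y (b ∷ [])  = here (¬-not λ off → b (cong not off))
      model .on-ȳ y (b ∷ [])  = here (cong not (¬-not b))
      model .on-z z _ with az z in eq
      ... | true  = here eq
      ... | false = there (here (cong not eq))
      model .on-clause i b    =
        ⊥-elim (All.All¬⇒¬Any (All.map star-falsified′ (clause-body⁻ b)) (sat i))
        where
        star-falsified′ : ∀ {L} → M (star L) ≡ true → ¬ satQLit (assign ax ay az) L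
        star-falsified′ t s = star-falsified s t
      model .on-z-sat z (() ∷ _)
      model .on-z̄-sat z (() ∷ _)
      model .on-W (_ ∷ ¬¬U ∷ []) = ⊥-elim (¬¬U λ ())

    encode-minimal : ∀ {ay az} N → N ⊆ encode ay az → IsModelFLP P (encode ay az) N →
                     encode ay az ⊆ N
    encode-minimal N N⊆M flp (orig (X x)) on = x-fact flp on
    encode-minimal N N⊆M flp (bar (X x))  on = x̄-fact flp on
    encode-minimal N N⊆M flp (orig (Y y)) on = y-default flp (not-both on) (not-both on ∘ N⊆M _)
    encode-minimal N N⊆M flp (bar (Y y))  on =
      ȳ-default flp (λ My → not-both My on) (λ Ny → not-both (N⊆M _ Ny) on)
    encode-minimal N N⊆M flp (orig (Z z)) on with z-choice flp
    ... | inj₁ Nz = Nz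
    ... | inj₂ Nz̄ = ⊥-elim (not-both on (N⊆M _ Nz̄))
    encode-minimal N N⊆M flp (bar (Z z))  on with z-choice flp
    ... | inj₁ Nz = ⊥-elim (not-both (N⊆M _ Nz) on)
    ... | inj₂ Nz̄ = Nz̄

    encode-answerSet : ∀ {ay az} → Satisfies Θ (assign ax ay az) → AnswerSet P (encode ay az)
    encode-answerSet sat = answerSet-intro (encode-model sat) encode-minimal

    U∉answerSet : (∀ ay → ∃[ az ] Satisfies Θ (assign ax ay az)) →
                  ∀ {M} → AnswerSet P M → ¬ M U ≡ true
    U∉answerSet valid {M} (model , minimal) MU =
      minimal (encode ay az) (encode⊆M , U , MU , refl) (model⇒FLP (encode-model sat))
      where
      ay : Fin (ny Θ) → Bool
      ay y = M (orig (Y y))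
      az = proj₁ (valid ay)
      sat = proj₂ (valid ay)
      flp : IsModelFLP P M M
      flp = model⇒FLP model
      encode⊆M : encode ay az ⊆ M
      encode⊆M (orig (X x)) on = x-fact flp on
      encode⊆M (bar (X x))  on = x̄-fact flp on
      encode⊆M (orig (Y y)) on = on
      encode⊆M (bar (Y y))  on = ȳ-default flp ¬My ¬My
        where ¬My = λ My → not-both My on
      encode⊆M (orig (Z z)) _  = z-saturated flp MU MU
      encode⊆M (bar (Z z))  _  = z̄-saturated flp MU MU

    guess⇒IsElit : ∀ ℓ → guess ℓ ≡ true → IsElit ℓ
    guess⇒IsElit (pos (orig (X x))) _ = elit-x x
    guess⇒IsElit (pos (bar (X x)))  _ = elit-x̄ x
    guess⇒IsElit (pos W)            _ = elit-W
    guess⇒IsElit (pos (orig (Y _))) ()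
    guess⇒IsElit (pos (orig (Z _))) ()
    guess⇒IsElit (pos (bar (Y _)))  ()
    guess⇒IsElit (pos (bar (Z _)))  ()
    guess⇒IsElit (pos U)            ()
    guess⇒IsElit (neg _)            ()

    guess-refuted : ∀ {ay az ℓ} → IsElit ℓ → guess ℓ ≡ true → ¬ satLit (encode ay az) ℓ
    guess-refuted (elit-x x) on = λ Mx → not-both Mx on
    guess-refuted (elit-x̄ x) on = not-both on
    guess-refuted elit-W     _  = λ ()

    unguessed-held : (∀ ay → ∃[ az ] Satisfies Θ (assign ax ay az)) →
                     ∀ {ℓ} → IsElit ℓ → guess ℓ ≡ false → ∀ M → AnswerSet P M → satLit M ℓ
    unguessed-held _     (elit-x x) off M (model , _) = x-fact (model⇒FLP {M = M} model) (not-injective off)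
    unguessed-held _     (elit-x̄ x) off M (model , _) = x̄-fact (model⇒FLP {M = M} model) (cong not off)
    unguessed-held valid elit-¬U    _   _ as          = U∉answerSet valid as

    candidate : (∀ ay → ∃[ az ] Satisfies Θ (assign ax ay az)) → CandidateWorldView Π guess
    candidate valid =
        (λ ℓ on → IsElit⇒Elit (guess⇒IsElit ℓ on))
      , (encode ay₀ az₀ , encode-answerSet sat₀)
      , (λ ℓ on → encode ay₀ az₀ , encode-answerSet sat₀ , guess-refuted (guess⇒IsElit ℓ on) on)
      , (λ ℓ el → unguessed-held valid (Elit⇒IsElit el))
      where
      ay₀ : Fin (ny Θ) → Bool
      ay₀ = const false
      az₀ = proj₁ (valid ay₀)
      sat₀ = proj₂ (valid ay₀)

  module Backward (Φ : Lit Atom → Bool)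
                  (someAnswerSet : ∃[ M ] AnswerSet (reduct Π Φ) M)
                  (refuted : ∀ ℓ → Φ ℓ ≡ true → ∃[ M ] (AnswerSet (reduct Π Φ) M × ¬ satLit M ℓ))
                  (held : ∀ ℓ → Elit Π ℓ → Φ ℓ ≡ false → ∀ M → AnswerSet (reduct Π Φ) M → satLit M ℓ)
                  where

    open Reduct Φ

    withoutW : Interp Atom → Interp Atom
    withoutW M (orig v) = M (orig v)
    withoutW M (bar v)  = M (bar v)
    withoutW M U        = M U
    withoutW M W        = false

    -- With W ∉ Φ the reduct of the W-rule has the body ¬W, so nothing supports W.
    W-unsupported : Φ (pos W) ≡ false → ∀ {M} → AnswerSet P M → ¬ M W ≡ true
    W-unsupported off {M} (model , minimal) MW =
      minimal (withoutW M) (withoutW⊆M , W , MW , refl) (forEachReducedRule flp)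
      where
      withoutW⊆M : withoutW M ⊆ M
      withoutW⊆M (orig v) = λ t → t
      withoutW⊆M (bar v)  = λ t → t
      withoutW⊆M U        = λ t → t

      unchanged : ∀ {r} → r ∈ Π → BodySat M (reduceRule Φ r) → HeadSat M (reduceRule Φ r)
      unchanged r∈ = model _ (reduceRule∈reduct r∈)

      flp : ForEachRule λ r → BodySat M (reduceRule Φ r) → BodySat (withoutW M) (reduceRule Φ r) →
                               HeadSat (withoutW M) (reduceRule Φ r)
      flp .on-x x b _       = here (Any.singleton⁻ (unchanged (x-rule∈Π x) b))
      flp .on-x̄ x b _       = here (Any.singleton⁻ (unchanged (x̄-rule∈Π x) b))
      flp .on-y y b _       = here (Any.singleton⁻ (unchanged (y-rule∈Π y) b))
      flp .on-ȳ y b _       = here (Any.singleton⁻ (unchanged (ȳ-rule∈Π y) b))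
      flp .on-z z b _ with unchanged (z-rule∈Π z) b
      ... | here Mz         = here Mz
      ... | there (here Mz̄) = there (here Mz̄)
      flp .on-clause i b _  = here (Any.singleton⁻ (unchanged (clause-rule∈Π i) b))
      flp .on-z-sat z b _   = here (Any.singleton⁻ (unchanged (z-sat-rule∈Π z) b))
      flp .on-z̄-sat z b _   = here (Any.singleton⁻ (unchanged (z̄-sat-rule∈Π z) b))
      flp .on-W (b ∷ _) _   = ⊥-elim (epi-¬⁻ off b MW)

    W∈Φ : Φ (pos W) ≡ true
    W∈Φ = ¬-not λ off →
      let M , as = someAnswerSet in
      W-unsupported off as (held (pos W) (IsElit⇒Elit elit-W) off M as)

    ¬U∉Φ : Φ (neg U) ≡ false
    ¬U∉Φ = ¬-not λ on →
      let M , (model , _) , ¬MW = refuted (pos W) W∈Φ in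
      ¬MW (Any.singleton⁻ (model _ (reduceRule∈reduct W-rule∈Π) (epi-⊤ W∈Φ ∷ epi-⊤ on ∷ [])))

    x-consistent : ∀ {x} → Φ (pos (orig (X x))) ≡ true → Φ (pos (bar (X x))) ≡ false
    x-consistent {x} on = ¬-not λ x̄-on →
      let M , (model , _) , ¬Mx = refuted (pos (orig (X x))) on in
      ¬Mx (x-fact (model⇒FLP {M = M} model) x̄-on)

    ax : Fin (nx Θ) → Bool
    ax x = not (Φ (pos (orig (X x))))

    saturated : (Fin (ny Θ) → Bool) → Interp Atom
    saturated ay (orig (X x)) = ax x
    saturated ay (bar (X x))  = Φ (pos (orig (X x)))
    saturated ay (orig (Y y)) = ay y
    saturated ay (bar (Y y))  = not (ay y)
    saturated ay (orig (Z z)) = true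
    saturated ay (bar (Z z))  = true
    saturated ay U            = true
    saturated ay W            = true

    saturated-model : ∀ ay → IsModel P (saturated ay)
    saturated-model ay = forEachReducedRule model
      where
      M = saturated ay
      model : ForEachRule λ r → BodySat M (reduceRule Φ r) → HeadSat M (reduceRule Φ r)
      model .on-x x (b ∷ [])  = here (cong not (¬-not λ on → epi-¬⁻ (x-consistent on) b on))
      model .on-x̄ x (b ∷ [])  = here (¬-not λ off → epi-¬⁻ off b (cong not off))
      model .on-y y (b ∷ [])  = here (¬-not λ off → b (cong not off))
      model .on-ȳ y (b ∷ [])  = here (cong not (¬-not b))
      model .on-z _ _         = here refl
      model .on-clause _ _    = here refl
      model .on-z-sat _ _     = here refl
      model .on-z̄-sat _ _     = here refl
      model .on-W _           = here refl

    -- If no Z-assignment works for (ax, ay), a model below the saturated interpretation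
    -- falsifies some clause at its own Z-part, hence derives U and then everything.
    saturated-minimal : ∀ ay → ¬ (∃[ az ] Satisfies Θ (assign ax ay az)) →
                        ∀ N → N ⊆ saturated ay → IsModelFLP P (saturated ay) N → saturated ay ⊆ N
    saturated-minimal ay unsat N N⊆M flp = forced
      where
      Nx : ∀ {x} → ax x ≡ true → N (orig (X x)) ≡ true
      Nx on = x-default flp (not-¬ (not-injective on)) (not-¬ (not-injective on) ∘ N⊆M _)

      Ny : ∀ {y} → ay y ≡ true → N (orig (Y y)) ≡ true
      Ny on = y-default flp (not-both on) (not-both on ∘ N⊆M _)

      Nȳ : ∀ {y} → not (ay y) ≡ true → N (bar (Y y)) ≡ true
      Nȳ on = ȳ-default flp (λ My → not-both My on) (λ Ny → not-both (N⊆M _ Ny) on)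

      azN : Fin (nz Θ) → Bool
      azN z = N (orig (Z z))

      star-forced : ∀ {L} → ¬ satQLit (assign ax ay azN) L → N (star L) ≡ true
      star-forced {posQ (X x)} unsat = x̄-fact flp (not-injective (¬-not unsat))
      star-forced {negQ (X x)} unsat = Nx (¬-not unsat)
      star-forced {posQ (Y y)} unsat = Nȳ (cong not (¬-not unsat))
      star-forced {negQ (Y y)} unsat = Ny (¬-not unsat)
      star-forced {posQ (Z z)} unsat with z-choice flp
      ... | inj₁ Nz  = ⊥-elim (unsat Nz)
      ... | inj₂ Nz̄ = Nz̄
      star-forced {negQ (Z z)} unsat = ¬-not unsat

      NU : N U ≡ true
      NU = U-derived flp (All.map (N⊆M _) Nstars) Nstars
        where
        falsified = ¬∀⟶∃¬ (k Θ) _ (λ i → Any.any? (satQLit? _) (matrix Θ i)) (λ sat → unsat (azN , sat))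
        Nstars = All.map star-forced (All.¬Any⇒All¬ _ (proj₂ falsified))

      forced : saturated ay ⊆ N
      forced (orig (X x)) on = Nx on
      forced (bar (X x))  on = x̄-fact flp on
      forced (orig (Y y)) on = Ny on
      forced (bar (Y y))  on = Nȳ on
      forced (orig (Z z)) _  = z-saturated flp refl NU
      forced (bar (Z z))  _  = z̄-saturated flp refl NU
      forced U            _  = NU
      forced W            _  = W-derived flp W∈Φ ¬U∉Φ refl NU

    valid : Valid Θ
    valid = ax , λ ay → decidable-stable (satisfiable? Θ ax ay) λ unsat →
      held (neg U) (IsElit⇒Elit elit-¬U) ¬U∉Φ (saturated ay)
           (answerSet-intro (saturated-model ay) (saturated-minimal ay unsat)) refl

  correct : Valid Θ ⇔ HasCandidateWorldView Π
  correct = mk⇔ (λ (ax , valid) → Forward.guess ax , Forward.candidate ax valid)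
                (λ (Φ , _ , someAnswerSet , refuted , held) → Backward.valid Φ someAnswerSet refuted held)

mainTheorem5 : (Θ : QBF) → Valid Θ ⇔ HasCandidateWorldView (PiTheta Θ)
mainTheorem5 Θ = ⇔-trans (extend-valid Θ) (ShenEiter.correct (extend Θ))
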